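{- Let $H$ be a graph each of whose connected components is a path or a subdivided star. Then the class of subdivisions of $H$ has the induced Erdős–Pósa property with a bounding function of order $\mathcal{O}(k)$.
   Context: All graphs are finite and simple. A subdivision of $H$ is obtained by repeatedly replacing an edge by a path of length two through a new vertex; a subdivided star is a subdivision of a star $K_{1,r}$. A class $\mathcal{F}$ of graphs has the induced Erdős–Pósa property with bounding function $f$ if for every graph $G$ and every positive integer $k$, $G$ contains either $k$ pairwise vertex-disjoint induced subgraphs belonging to $\mathcal{F}$, or a vertex set of size at most $f(k)$ meeting every induced subgraph of $G$ belonging to $\mathcal{F}$. -}

module Defs where

open import Data.Nat using (ℕ; zero; suc; _≡ᵇ_; _≤_; _*_)
open import Data.Fin using (Fin; zero; suc; toℕ; _≟_)
open import Data.Bool using (Bool; true; false; _∧_; _∨_; not)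
open import Data.List using (List; length)
open import Data.List.Membership.Propositional using (_∈_)
open import Data.Product using (Σ; ∃; _×_; _,_; proj₁)
open import Data.Sum using (_⊎_)
open import Function.Definitions using (Injective)
open import Relation.Binary.PropositionalEquality using (_≡_; _≢_)
open import Relation.Nullary.Decidable using (⌊_⌋)

record Graph (n : ℕ) : Set where
  field
    adj    : Fin n → Fin n → Bool
    sym    : ∀ x y → adj x y ≡ adj y x
    irrefl : ∀ x → adj x x ≡ false
open Graph public

_==_ : ∀ {n} → Fin n → Fin n → Bool
x == y = ⌊ x ≟ y ⌋

record Iso {m n : ℕ} (G : Graph m) (H : Graph n) : Set where
  field
    to      : Fin m → Fin n
    from    : Fin n → Fin m
    from-to : ∀ x → from (to x) ≡ x
    to-from : ∀ y → to (from y) ≡ y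
    adj-pres : ∀ x y → adj G x y ≡ adj H (to x) (to y)

-- The subgraph of G induced on the image of φ (φ injective in uses below).
Induce : ∀ {m n} → Graph n → (Fin m → Fin n) → Graph m
Induce G φ = record
  { adj = λ x y → adj G (φ x) (φ y)
  ; sym = λ x y → sym G (φ x) (φ y)
  ; irrefl = λ x → irrefl G (φ x) }

-- G' (on Fin (suc m)) arises from G (on Fin m) by subdividing the edge uv:
-- the new vertex is zero, old vertex x is suc x.
SubdivideOnce : ∀ {m} → Graph m → Graph (suc m) → Set
SubdivideOnce {m} G G' =
  Σ (Fin m) λ u → Σ (Fin m) λ v →
    (adj G u v ≡ true)
    × (∀ x y → adj G' (suc x) (suc y)
                ≡ (adj G x y ∧ not (((x == u) ∧ (y == v)) ∨ ((x == v) ∧ (y == u)))))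
    × (∀ x → adj G' zero (suc x) ≡ ((x == u) ∨ (x == v)))

data Subdivision {h : ℕ} (H : Graph h) : ∀ {m} → Graph m → Set where
  base : ∀ {m} {S : Graph m} → Iso H S → Subdivision H S
  step : ∀ {m} {S : Graph m} {S' : Graph (suc m)} →
         Subdivision H S → SubdivideOnce S S' → Subdivision H S'

IsPathGraph : ∀ {n} → Graph n → Set
IsPathGraph {n} P = ∀ i j → adj P i j ≡ ((suc (toℕ i) ≡ᵇ toℕ j) ∨ (suc (toℕ j) ≡ᵇ toℕ i))

isZero : ∀ {n} → Fin n → Bool
isZero zero = true
isZero (suc _) = false

IsStarGraph : ∀ {n} → Graph n → Set
IsStarGraph S = ∀ i j → adj S i j ≡ ((isZero i ∧ not (isZero j)) ∨ (isZero j ∧ not (isZero i)))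

IsPath : ∀ {m} → Graph m → Set
IsPath C = Σ ℕ λ p → Σ (Graph p) λ P → IsPathGraph P × Iso P C

IsSubdividedStar : ∀ {m} → Graph m → Set
IsSubdividedStar C = Σ ℕ λ r → Σ (Graph (suc r)) λ S → IsStarGraph S × Subdivision S C

data Reach {n} (G : Graph n) (x : Fin n) : Fin n → Set where
  here : Reach G x x
  there : ∀ {y z} → Reach G x y → adj G y z ≡ true → Reach G x z

-- Every connected component of H is a path or a subdivided star:
-- for each vertex v, the subgraph induced on the component of v is one of them.
ComponentsPathsOrSubdividedStars : ∀ {h} → Graph h → Set
ComponentsPathsOrSubdividedStars {h} H =
  ∀ v → Σ ℕ λ m → Σ (Fin m → Fin h) λ φ →
    Injective _≡_ _≡_ φ
    × (∀ u → (Reach H v u → ∃ λ i → φ i ≡ u) × (∀ i → φ i ≡ u → Reach H v u))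
    × (IsPath (Induce H φ) ⊎ IsSubdividedStar (Induce H φ))

record SubdivCopy {h n : ℕ} (H : Graph h) (G : Graph n) : Set where
  field
    size  : ℕ
    emb   : Fin size → Fin n
    inj   : Injective _≡_ _≡_ emb
    isSub : Subdivision H (Induce G emb)
open SubdivCopy public

DisjointCopies : ∀ {h n} (H : Graph h) (G : Graph n) (k : ℕ) → Set
DisjointCopies H G k =
  Σ (Fin k → SubdivCopy H G) λ cs →
    ∀ i j → i ≢ j → ∀ a b → emb (cs i) a ≢ emb (cs j) b

HittingSet : ∀ {h n} (H : Graph h) (G : Graph n) (bound : ℕ) → Set
HittingSet {n = n} H G bound =
  Σ (List (Fin n)) λ X → length X ≤ bound ×
    (∀ (C : SubdivCopy H G) → ∃ λ a → emb C a ∈ X)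

-- Call an edge pendant if, suitably oriented, it starts an induced path through vertices of degree
-- two that ends in a leaf. Subdividing a pendant edge only lengthens its pendant path, so the result
-- contains the original graph as an induced subgraph. The property survives subdivision, so it holds in
-- paths and subdivided stars, hence in H. By induction on the subdivision steps every subdivision of H
-- then contains an induced copy of H: if the subdivided edge lies in the copy, the copy together with
-- the new vertex is H with one pendant edge subdivided. So a set meeting all induced copies of H meets
-- all induced subdivisions of H, and choosing disjoint copies greedily either finds k of them or
-- leaves the at most k |V(H)| chosen vertices as such a set.
module Submission where

open import Defs renaming (sym to adj-sym)
open import Data.Bool using (Bool; true; false; _∧_; _∨_; not; if_then_else_)
open import Data.Bool.Properties using (∧-identityʳ; ∧-zeroʳ; ∧-conicalˡ; ∨-zeroʳ; ∨-comm; ¬-not; T-≡)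
import Data.Bool.Properties as Bool
open import Data.Empty using (⊥-elim)
open import Data.Fin using (Fin; zero; suc; toℕ; fromℕ<; _≟_)
open import Data.Fin.Properties using (suc-injective; 0≢1+n; toℕ-injective; toℕ-fromℕ<; toℕ<n; any?; all?)
open import Data.List using (List; []; _++_; length; tabulate)
open import Data.List.Properties using (length-++; length-tabulate)
open import Data.List.Membership.Propositional using (_∈_; _∉_)
open import Data.List.Membership.Propositional.Properties using (∈-tabulate⁺; ∈-++⁺ˡ; ∈-++⁺ʳ)
import Data.List.Membership.DecPropositional as DecMembership
open import Data.Nat using (ℕ; zero; suc; _+_; _*_; _∸_; _<_; _≤_; _≡ᵇ_)
open import Data.Nat.Properties
  using (≡ᵇ⇒≡; ≡⇒≡ᵇ; <⇒≢; +-identityʳ; +-suc; ≤-trans; ≤-reflexive; m≤m+n; m≢1+n+m; m+[n∸m]≡n;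
         *-zeroʳ; *-suc; *-monoʳ-≤; n≤1+n)
import Data.Nat.Properties as ℕ
open import Data.Product using (Σ; ∃; ∃₂; _×_; _,_; proj₁; proj₂)
open import Data.Sum using (_⊎_; inj₁; inj₂; [_,_]′)
import Data.Sum as Sum
open import Data.Vec.Functional using (_∷_)
open import Function.Bundles using (Equivalence)
open import Function.Definitions using (Injective)
open import Relation.Binary.PropositionalEquality
open import Relation.Nullary using (Dec; yes; no; ¬_; does)
open import Relation.Nullary.Decidable
  using (isYes≗does; dec-true; dec-false; map′; _×-dec_; _⊎-dec_; _→-dec_; ¬?)
import Relation.Nullary.Decidable as Dec

true≢false : true ≢ false
true≢false ()

∨≡true⇒ : ∀ {p q} → (p ∨ q) ≡ true → p ≡ true ⊎ q ≡ true
∨≡true⇒ {true}  _ = inj₁ refl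
∨≡true⇒ {false} e = inj₂ e

≡⇒== : ∀ {n} {x y : Fin n} → x ≡ y → (x == y) ≡ true
≡⇒== {x = x} {y} p = trans (isYes≗does (x ≟ y)) (dec-true (x ≟ y) p)

≢⇒==false : ∀ {n} {x y : Fin n} → x ≢ y → (x == y) ≡ false
≢⇒==false {x = x} {y} p = trans (isYes≗does (x ≟ y)) (dec-false (x ≟ y) p)

==⇒≡ : ∀ {n} {x y : Fin n} → (x == y) ≡ true → x ≡ y
==⇒≡ {x = x} {y} e with x ≟ y
... | yes p = p

==-injective : ∀ {m n} {f : Fin m → Fin n} → Injective _≡_ _≡_ f → ∀ x y → (f x == f y) ≡ (x == y)
==-injective {f = f} f-inj x y with x ≟ y
... | yes p = ≡⇒== (cong f p)
... | no ¬p = ≢⇒==false (λ q → ¬p (f-inj q))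

adj⇒≢ : ∀ {n} (G : Graph n) {x y} → adj G x y ≡ true → x ≢ y
adj⇒≢ G {x} e refl = true≢false (trans (sym e) (irrefl G x))

infix 4 _↪_

record _↪_ {h m} (H : Graph h) (S : Graph m) : Set where
  constructor embedding
  field
    embed           : Fin h → Fin m
    embed-injective : Injective _≡_ _≡_ embed
    embed-adj       : ∀ x y → adj S (embed x) (embed y) ≡ adj H x y

↪-trans : ∀ {a b c} {A : Graph a} {B : Graph b} {C : Graph c} → A ↪ B → B ↪ C → A ↪ C
↪-trans (embedding f f-inj f-adj) (embedding g g-inj g-adj) =
  embedding (λ x → g (f x)) (λ e → f-inj (g-inj e)) (λ x y → trans (g-adj (f x) (f y)) (f-adj x y))

Iso⇒↪ : ∀ {a b} {A : Graph a} {B : Graph b} → Iso A B → A ↪ B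
Iso⇒↪ i = embedding to to-injective (λ x y → sym (adj-pres x y))
  where
  open Iso i
  to-injective : Injective _≡_ _≡_ to
  to-injective {x} {y} e = trans (sym (from-to x)) (trans (cong from e) (from-to y))

Induce-↪ : ∀ {m n} (G : Graph n) {φ : Fin m → Fin n} → Injective _≡_ _≡_ φ → Induce G φ ↪ G
Induce-↪ G {φ} φ-inj = embedding φ φ-inj (λ _ _ → refl)

-- Subdividing a single edge

SameEdge : ∀ {n} → Fin n → Fin n → Fin n → Fin n → Set
SameEdge x y u v = (x ≡ u × y ≡ v) ⊎ (x ≡ v × y ≡ u)

sameEdgeᵇ : ∀ {n} → Fin n → Fin n → Fin n → Fin n → Bool
sameEdgeᵇ x y u v = ((x == u) ∧ (y == v)) ∨ ((x == v) ∧ (y == u))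

SameEdge? : ∀ {n} (x y u v : Fin n) → Dec (SameEdge x y u v)
SameEdge? x y u v = (x ≟ u ×-dec y ≟ v) ⊎-dec (x ≟ v ×-dec y ≟ u)

sameEdgeᵇ≡does : ∀ {n} (x y u v : Fin n) → sameEdgeᵇ x y u v ≡ does (SameEdge? x y u v)
sameEdgeᵇ≡does x y u v =
  cong₂ _∨_ (cong₂ _∧_ (isYes≗does (x ≟ u)) (isYes≗does (y ≟ v)))
            (cong₂ _∧_ (isYes≗does (x ≟ v)) (isYes≗does (y ≟ u)))

sameEdgeᵇ-true : ∀ {n} {x y u v : Fin n} → SameEdge x y u v → sameEdgeᵇ x y u v ≡ true
sameEdgeᵇ-true {x = x} {y} {u} {v} same = trans (sameEdgeᵇ≡does x y u v) (dec-true (SameEdge? x y u v) same)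

sameEdgeᵇ-false : ∀ {n} {x y u v : Fin n} → ¬ SameEdge x y u v → sameEdgeᵇ x y u v ≡ false
sameEdgeᵇ-false {x = x} {y} {u} {v} ¬same = trans (sameEdgeᵇ≡does x y u v) (dec-false (SameEdge? x y u v) ¬same)

SameEdge-sym : ∀ {n} {x y u v : Fin n} → SameEdge x y u v → SameEdge y x u v
SameEdge-sym (inj₁ (p , q)) = inj₂ (q , p)
SameEdge-sym (inj₂ (p , q)) = inj₁ (q , p)

SameEdge-endˡ : ∀ {n} {a b u v : Fin n} → SameEdge a b u v → a ≡ u ⊎ a ≡ v
SameEdge-endˡ (inj₁ (a≡u , _)) = inj₁ a≡u
SameEdge-endˡ (inj₂ (a≡v , _)) = inj₂ a≡v

SameEdge-ends : ∀ {n} {a b u v x : Fin n} → SameEdge a b u v → x ≡ u ⊎ x ≡ v → x ≡ a ⊎ x ≡ b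
SameEdge-ends (inj₁ (refl , refl)) x∈ = x∈
SameEdge-ends (inj₂ (refl , refl)) x∈ = Sum.swap x∈

SameEdge-next : ∀ {n} {a b c u v : Fin n} → u ≢ v → c ≢ a → SameEdge a b u v → ¬ SameEdge b c u v
SameEdge-next u≢v c≢a (inj₁ (_ , refl)) (inj₁ (b≡u , _)) = u≢v (sym b≡u)
SameEdge-next u≢v c≢a (inj₁ (refl , _)) (inj₂ (_ , c≡u)) = c≢a c≡u
SameEdge-next u≢v c≢a (inj₂ (refl , _)) (inj₁ (_ , c≡v)) = c≢a c≡v
SameEdge-next u≢v c≢a (inj₂ (_ , refl)) (inj₂ (b≡v , _)) = u≢v b≡v

record SubdividedAt {m} (G : Graph m) (G' : Graph (suc m)) (u v : Fin m) : Set where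
  constructor subdividedAt
  field
    edge    : adj G u v ≡ true
    old-adj : ∀ x y → adj G' (suc x) (suc y) ≡ (adj G x y ∧ not (sameEdgeᵇ x y u v))
    new-adj : ∀ x → adj G' zero (suc x) ≡ ((x == u) ∨ (x == v))

SubdivideOnce⇒SubdividedAt : ∀ {m} {G : Graph m} {G' : Graph (suc m)} →
  SubdivideOnce G G' → ∃₂ λ u v → SubdividedAt G G' u v
SubdivideOnce⇒SubdividedAt (u , v , e , old , new) = u , v , subdividedAt e old new

module _ {m} {G : Graph m} {G' : Graph (suc m)} {u v : Fin m} (s : SubdividedAt G G' u v) where
  open SubdividedAt s

  SubdividedAt-swap : SubdividedAt G G' v u
  SubdividedAt-swap = subdividedAt
    (trans (adj-sym G v u) edge)
    (λ x y → trans (old-adj x y) (cong (λ t → adj G x y ∧ not t) (∨-comm ((x == u) ∧ (y == v)) _)))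
    (λ x → trans (new-adj x) (∨-comm (x == u) (x == v)))

  old-adj-kept : ∀ {x y} → ¬ SameEdge x y u v → adj G' (suc x) (suc y) ≡ adj G x y
  old-adj-kept {x} {y} ¬same =
    trans (old-adj x y) (trans (cong (λ t → adj G x y ∧ not t) (sameEdgeᵇ-false ¬same)) (∧-identityʳ _))

  old-adj-cut : ∀ {x y} → SameEdge x y u v → adj G' (suc x) (suc y) ≡ false
  old-adj-cut {x} {y} same =
    trans (old-adj x y) (trans (cong (λ t → adj G x y ∧ not t) (sameEdgeᵇ-true same)) (∧-zeroʳ _))

  old-adj⇒adj : ∀ {x y} → adj G' (suc x) (suc y) ≡ true → adj G x y ≡ true
  old-adj⇒adj {x} {y} e = ∧-conicalˡ _ _ (trans (sym (old-adj x y)) e)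

  new-adj-end : ∀ {x} → x ≡ u ⊎ x ≡ v → adj G' zero (suc x) ≡ true
  new-adj-end {x} (inj₁ refl) = trans (new-adj x) (cong (_∨ (x == v)) (≡⇒== refl))
  new-adj-end {x} (inj₂ refl) = trans (new-adj x) (trans (cong ((x == u) ∨_) (≡⇒== refl)) (∨-zeroʳ _))

  new-adj-other : ∀ {x} → x ≢ u → x ≢ v → adj G' zero (suc x) ≡ false
  new-adj-other {x} x≢u x≢v = trans (new-adj x) (cong₂ _∨_ (≢⇒==false x≢u) (≢⇒==false x≢v))

  new-adj⇒end : ∀ {x} → adj G' zero (suc x) ≡ true → x ≡ u ⊎ x ≡ v
  new-adj⇒end {x} e with ∨≡true⇒ (trans (sym (new-adj x)) e)
  ... | inj₁ p = inj₁ (==⇒≡ p)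
  ... | inj₂ p = inj₂ (==⇒≡ p)

mkSubdividedAt : ∀ {m} {G : Graph m} {G' : Graph (suc m)} {u v : Fin m} → adj G u v ≡ true →
  (∀ {x y} → ¬ SameEdge x y u v → adj G' (suc x) (suc y) ≡ adj G x y) →
  (∀ {x y} → SameEdge x y u v → adj G' (suc x) (suc y) ≡ false) →
  (∀ {x} → x ≡ u ⊎ x ≡ v → adj G' zero (suc x) ≡ true) →
  (∀ {x} → x ≢ u → x ≢ v → adj G' zero (suc x) ≡ false) →
  SubdividedAt G G' u v
mkSubdividedAt {G = G} {G'} {u} {v} e kept cut end other = subdividedAt e old new
  where
  old : ∀ x y → adj G' (suc x) (suc y) ≡ (adj G x y ∧ not (sameEdgeᵇ x y u v))
  old x y with SameEdge? x y u v
  ... | yes p =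
    trans (cut p) (sym (trans (cong (λ t → adj G x y ∧ not t) (sameEdgeᵇ-true p)) (∧-zeroʳ _)))
  ... | no ¬p =
    trans (kept ¬p) (sym (trans (cong (λ t → adj G x y ∧ not t) (sameEdgeᵇ-false ¬p)) (∧-identityʳ _)))
  new : ∀ x → adj G' zero (suc x) ≡ ((x == u) ∨ (x == v))
  new x with x ≟ u | x ≟ v
  ... | yes p | _     = end (inj₁ p)
  ... | no _  | yes q = end (inj₂ q)
  ... | no p  | no q  = other p q

-- Pendant edges

data Pendant {n} (G : Graph n) : Fin n → Fin n → Set where
  leaf    : ∀ {a b} → adj G a b ≡ true → (∀ y → adj G b y ≡ true → y ≡ a) → Pendant G a b
  through : ∀ {a b c} → adj G a b ≡ true → c ≢ a → (∀ y → adj G b y ≡ true → y ≡ a ⊎ y ≡ c) →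
            Pendant G b c → Pendant G a b

Pendant-edge : ∀ {n} {G : Graph n} {a b} → Pendant G a b → adj G a b ≡ true
Pendant-edge (leaf e _)        = e
Pendant-edge (through e _ _ _) = e

PendantEdges : ∀ {n} → Graph n → Set
PendantEdges {n} G = ∀ (a b : Fin n) → adj G a b ≡ true → Pendant G a b ⊎ Pendant G b a

relocate : ∀ {m} → Fin m → Fin m → Fin (suc m)
relocate b x = if does (x ≟ b) then zero else suc x

relocate-injective : ∀ {m} (b : Fin m) → Injective _≡_ _≡_ (relocate b)
relocate-injective b {x} {y} e with x ≟ b | y ≟ b
... | yes p | yes q = trans p (sym q)
... | yes _ | no _  = ⊥-elim (0≢1+n e)
... | no _  | yes _ = ⊥-elim (0≢1+n (sym e))
... | no _  | no _  = suc-injective e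

relocate-self : ∀ {m} (b : Fin m) → relocate b b ≡ zero
relocate-self b with b ≟ b
... | yes _ = refl
... | no b≢b = ⊥-elim (b≢b refl)

relocate-other : ∀ {m} {b x : Fin m} → x ≢ b → relocate b x ≡ suc x
relocate-other {b = b} {x} x≢b with x ≟ b
... | yes x≡b = ⊥-elim (x≢b x≡b)
... | no _ = refl

swapNew : ∀ {m} → Fin m → Fin (suc m) → Fin (suc m)
swapNew b zero    = suc b
swapNew b (suc x) = relocate b x

swapNew-injective : ∀ {m} (b : Fin m) → Injective _≡_ _≡_ (swapNew b)
swapNew-injective b {zero}  {zero}  _ = refl
swapNew-injective b {zero}  {suc y} e with y ≟ b
... | yes _ = ⊥-elim (0≢1+n (sym e))
... | no y≢b = ⊥-elim (y≢b (sym (suc-injective e)))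
swapNew-injective b {suc x} {zero}  e = sym (swapNew-injective b {zero} {suc x} (sym e))
swapNew-injective b {suc x} {suc y} e = cong suc (relocate-injective b e)

module _ {h} {H : Graph h} {H' : Graph (suc h)} {a b : Fin h} (s : SubdividedAt H H' a b) where
  open SubdividedAt s

  new-adj-as-b : ∀ {y} → y ≢ b → (adj H b y ≡ true → y ≡ a) → adj H' zero (suc y) ≡ adj H b y
  new-adj-as-b {y} y≢b nb with y ≟ a
  ... | yes refl = trans (new-adj-end s (inj₁ refl)) (sym (trans (adj-sym H b y) edge))
  ... | no y≢a   = trans (new-adj-other s y≢a y≢b) (sym (¬-not λ e → y≢a (nb e)))

  ↪-subdivide-leaf : (∀ y → adj H b y ≡ true → y ≡ a) → H ↪ H'
  ↪-subdivide-leaf nb = embedding (relocate b) (relocate-injective b) relocate-adj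
    where
    relocate-adj : ∀ x y → adj H' (relocate b x) (relocate b y) ≡ adj H x y
    relocate-adj x y with x ≟ b | y ≟ b
    ... | yes refl | yes refl = trans (irrefl H' zero) (sym (irrefl H x))
    ... | yes refl | no y≢b   = new-adj-as-b y≢b (nb y)
    ... | no x≢b   | yes refl =
      trans (adj-sym H' (suc x) zero) (trans (new-adj-as-b x≢b (nb x)) (adj-sym H y x))
    ... | no x≢b   | no y≢b   =
      old-adj-kept s λ { (inj₁ (_ , y≡b)) → y≢b y≡b ; (inj₂ (x≡b , _)) → x≢b x≡b }

  -- Exchanging the subdivision vertex with b shows that H' is also the subdivision of H at bc.
  SubdividedAt-next : ∀ {c} → c ≢ a → (∀ y → adj H b y ≡ true → y ≡ a ⊎ y ≡ c) →
                      adj H b c ≡ true →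
                      SubdividedAt H (Induce H' (swapNew b)) b c
  SubdividedAt-next {c} c≢a nb bc = mkSubdividedAt bc kept cut end other
    where
    a≢b : a ≢ b
    a≢b = adj⇒≢ H edge
    c≢b : c ≢ b
    c≢b c≡b = adj⇒≢ H bc (sym c≡b)
    nb-a : ∀ {y} → y ≢ c → adj H b y ≡ true → y ≡ a
    nb-a {y} y≢c e with nb y e
    ... | inj₁ y≡a = y≡a
    ... | inj₂ y≡c = ⊥-elim (y≢c y≡c)
    kept : ∀ {x y} → ¬ SameEdge x y b c → adj H' (relocate b x) (relocate b y) ≡ adj H x y
    kept {x} {y} ¬same with x ≟ b | y ≟ b
    ... | yes refl | yes refl = trans (irrefl H' zero) (sym (irrefl H x))
    ... | yes refl | no y≢b   = new-adj-as-b y≢b (nb-a λ y≡c → ¬same (inj₁ (refl , y≡c)))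
    ... | no x≢b   | yes refl =
      trans (adj-sym H' (suc x) zero)
            (trans (new-adj-as-b x≢b (nb-a λ x≡c → ¬same (inj₂ (x≡c , refl)))) (adj-sym H y x))
    ... | no x≢b   | no y≢b   =
      old-adj-kept s λ { (inj₁ (_ , y≡b)) → y≢b y≡b ; (inj₂ (x≡b , _)) → x≢b x≡b }
    cut : ∀ {x y} → SameEdge x y b c → adj H' (relocate b x) (relocate b y) ≡ false
    cut (inj₁ (refl , refl)) =
      trans (cong₂ (adj H') (relocate-self b) (relocate-other c≢b)) (new-adj-other s c≢a c≢b)
    cut (inj₂ (refl , refl)) =
      trans (cong₂ (adj H') (relocate-other c≢b) (relocate-self b))
            (trans (adj-sym H' _ zero) (new-adj-other s c≢a c≢b))
    end : ∀ {x} → x ≡ b ⊎ x ≡ c → adj H' (suc b) (relocate b x) ≡ true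
    end (inj₁ refl) =
      trans (cong (adj H' (suc b)) (relocate-self b))
            (trans (adj-sym H' (suc b) zero) (new-adj-end s (inj₂ refl)))
    end (inj₂ refl) =
      trans (cong (adj H' (suc b)) (relocate-other c≢b))
            (trans (old-adj-kept s λ { (inj₁ (b≡a , _)) → a≢b (sym b≡a) ; (inj₂ (_ , c≡a)) → c≢a c≡a })
                   bc)
    other : ∀ {x} → x ≢ b → x ≢ c → adj H' (suc b) (relocate b x) ≡ false
    other {x} x≢b x≢c = trans (cong (adj H' (suc b)) (relocate-other x≢b)) (b-to-x x≢c)
      where
      b-to-x : x ≢ c → adj H' (suc b) (suc x) ≡ false
      b-to-x x≢c with x ≟ a
      ... | yes refl = old-adj-cut s (inj₂ (refl , refl))
      ... | no x≢a   =
        trans (old-adj-kept s λ { (inj₁ (b≡a , _)) → a≢b (sym b≡a) ; (inj₂ (_ , x≡a)) → x≢a x≡a })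
              (¬-not λ e → [ x≢a , x≢c ]′ (nb x e))

Pendant⇒↪-subdivision : ∀ {h} {H : Graph h} {a b} → Pendant H a b →
                        ∀ {H' : Graph (suc h)} → SubdividedAt H H' a b → H ↪ H'
Pendant⇒↪-subdivision (leaf _ nb) s = ↪-subdivide-leaf s nb
Pendant⇒↪-subdivision (through _ c≢a nb p) {H'} s =
  ↪-trans (Pendant⇒↪-subdivision p (SubdividedAt-next s c≢a nb (Pendant-edge p)))
          (Induce-↪ H' (swapNew-injective _))

PendantEdges⇒↪-SubdivideOnce : ∀ {h} {H : Graph h} → PendantEdges H →
                               ∀ {H' : Graph (suc h)} → SubdivideOnce H H' → H ↪ H'
PendantEdges⇒↪-SubdivideOnce pendant d with SubdivideOnce⇒SubdividedAt d
... | u , v , s with pendant u v (SubdividedAt.edge s)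
...   | inj₁ p = Pendant⇒↪-subdivision p s
...   | inj₂ p = Pendant⇒↪-subdivision p (SubdividedAt-swap s)

extendNew : ∀ {h m} → (Fin h → Fin m) → Fin (suc h) → Fin (suc m)
extendNew ψ zero    = zero
extendNew ψ (suc x) = suc (ψ x)

extendNew-injective : ∀ {h m} {ψ : Fin h → Fin m} → Injective _≡_ _≡_ ψ →
                      Injective _≡_ _≡_ (extendNew ψ)
extendNew-injective ψ-inj {zero}  {zero}  _ = refl
extendNew-injective ψ-inj {suc x} {suc y} e = cong suc (ψ-inj (suc-injective e))

↪-avoiding-SubdividedAt : ∀ {h m} {H : Graph h} {S : Graph m} {S' : Graph (suc m)} {u v : Fin m} →
  (f : H ↪ S) → SubdividedAt S S' u v →
  (∀ x → _↪_.embed f x ≢ u) ⊎ (∀ x → _↪_.embed f x ≢ v) → H ↪ S'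
↪-avoiding-SubdividedAt {u = u} {v} (embedding ψ ψ-inj ψ-adj) s missed =
  embedding (λ x → suc (ψ x)) (λ e → ψ-inj (suc-injective e))
            (λ x y → trans (old-adj-kept s (¬same missed)) (ψ-adj x y))
  where
  ¬same : ∀ {x y} → (∀ x → ψ x ≢ u) ⊎ (∀ x → ψ x ≢ v) → ¬ SameEdge (ψ x) (ψ y) u v
  ¬same {x}     (inj₁ ∄u) (inj₁ (e , _)) = ∄u x e
  ¬same {y = y} (inj₁ ∄u) (inj₂ (_ , e)) = ∄u y e
  ¬same {y = y} (inj₂ ∄v) (inj₁ (_ , e)) = ∄v y e
  ¬same {x}     (inj₂ ∄v) (inj₂ (e , _)) = ∄v x e

-- If the subdivided edge lies in the copy of H, the copy together with the new vertex is a subdivision of H.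
↪-SubdivideOnce : ∀ {h} {H : Graph h} → PendantEdges H →
                  ∀ {m} {S : Graph m} {S' : Graph (suc m)} → H ↪ S → SubdivideOnce S S' → H ↪ S'
↪-SubdivideOnce {H = H} pendant {S' = S'} f@(embedding ψ ψ-inj ψ-adj) (u , v , uv , old , new)
  with any? (λ a → ψ a ≟ u) | any? (λ b → ψ b ≟ v)
... | yes (a , refl) | yes (b , refl) =
  ↪-trans (PendantEdges⇒↪-SubdivideOnce pendant once) (Induce-↪ S' (extendNew-injective ψ-inj))
  where
  ==-ψ : ∀ x y → (ψ x == ψ y) ≡ (x == y)
  ==-ψ = ==-injective ψ-inj
  once : SubdivideOnce H (Induce S' (extendNew ψ))
  once = a , b , trans (sym (ψ-adj a b)) uv
       , (λ x y → trans (old (ψ x) (ψ y))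
                        (cong₂ (λ A B → A ∧ not B) (ψ-adj x y)
                               (cong₂ _∨_ (cong₂ _∧_ (==-ψ x a) (==-ψ y b))
                                          (cong₂ _∧_ (==-ψ x b) (==-ψ y a)))))
       , λ x → trans (new (ψ x)) (cong₂ _∨_ (==-ψ x a) (==-ψ x b))
... | no ∄u | _ = ↪-avoiding-SubdividedAt f (subdividedAt uv old new) (inj₁ λ x e → ∄u (x , e))
... | yes _ | no ∄v = ↪-avoiding-SubdividedAt f (subdividedAt uv old new) (inj₂ λ x e → ∄v (x , e))

PendantEdges⇒↪-Subdivision : ∀ {h} {H : Graph h} → PendantEdges H →
                             ∀ {m} {S : Graph m} → Subdivision H S → H ↪ S
PendantEdges⇒↪-Subdivision pendant (base i)      = Iso⇒↪ i
PendantEdges⇒↪-Subdivision pendant (step d once) =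
  ↪-SubdivideOnce pendant (PendantEdges⇒↪-Subdivision pendant d) once

-- Graphs all of whose edges are pendant

NeighbourClosed : ∀ {m n} {G : Graph m} {K : Graph n} → G ↪ K → Set
NeighbourClosed {m} {n} {K = K} f =
  ∀ (i : Fin m) (y : Fin n) → adj K (embed i) y ≡ true → ∃ λ j → embed j ≡ y
  where open _↪_ f

module _ {m n} {G : Graph m} {K : Graph n} (f : G ↪ K) (closed : NeighbourClosed f) where
  open _↪_ f

  Pendant-map : ∀ {a b} → Pendant G a b → Pendant K (embed a) (embed b)
  Pendant-map {a} {b} (leaf e nb) = leaf (trans (embed-adj a b) e) nb′
    where
    nb′ : ∀ y → adj K (embed b) y ≡ true → y ≡ embed a
    nb′ y e′ with closed b y e′
    ... | j , refl = cong embed (nb j (trans (sym (embed-adj b j)) e′))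
  Pendant-map {a} {b} (through {c = c} e c≢a nb p) =
    through (trans (embed-adj a b) e) (λ q → c≢a (embed-injective q)) nb′ (Pendant-map p)
    where
    nb′ : ∀ y → adj K (embed b) y ≡ true → y ≡ embed a ⊎ y ≡ embed c
    nb′ y e′ with closed b y e′
    ... | j , refl with nb j (trans (sym (embed-adj b j)) e′)
    ...   | inj₁ j≡a = inj₁ (cong embed j≡a)
    ...   | inj₂ j≡c = inj₂ (cong embed j≡c)

  PendantEdges-↪ : PendantEdges G → ∀ {a b} → adj K (embed a) (embed b) ≡ true →
                   Pendant K (embed a) (embed b) ⊎ Pendant K (embed b) (embed a)
  PendantEdges-↪ pendant {a} {b} e with pendant a b (trans (sym (embed-adj a b)) e)
  ... | inj₁ p = inj₁ (Pendant-map p)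
  ... | inj₂ p = inj₂ (Pendant-map p)

PendantEdges-Iso : ∀ {m n} {G : Graph m} {K : Graph n} → Iso G K → PendantEdges G → PendantEdges K
PendantEdges-Iso {K = K} i pendant a b e
  rewrite sym (Iso.to-from i a) | sym (Iso.to-from i b) =
  PendantEdges-↪ (Iso⇒↪ i) (λ _ y _ → Iso.from i y , Iso.to-from i y) pendant e

module _ {m} {G : Graph m} {G' : Graph (suc m)} {u v : Fin m} (s : SubdividedAt G G' u v) where
  open SubdividedAt s

  neighbours-of-old : ∀ {b y} → adj G' (suc b) y ≡ true →
    (y ≡ zero × (b ≡ u ⊎ b ≡ v)) ⊎ (∃ λ x → y ≡ suc x × adj G b x ≡ true × ¬ SameEdge b x u v)
  neighbours-of-old {b} {zero}  e = inj₁ (refl , new-adj⇒end s (trans (adj-sym G' zero (suc b)) e))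
  neighbours-of-old {b} {suc x} e =
    inj₂ (x , refl , old-adj⇒adj s e , λ same → true≢false (trans (sym e) (old-adj-cut s same)))

  partner : ∀ {b} → b ≡ u ⊎ b ≡ v → ∃ λ w → adj G b w ≡ true × SameEdge w b u v
  partner (inj₁ refl) = v , edge , inj₂ (refl , refl)
  partner (inj₂ refl) = u , trans (adj-sym G v u) edge , inj₁ (refl , refl)

  mutual
    Pendant-lift : ∀ {a b} → Pendant G a b → ¬ SameEdge a b u v → Pendant G' (suc a) (suc b)
    Pendant-lift {a} {b} (leaf e nb) ¬ab = leaf (trans (old-adj-kept s ¬ab) e) nb′
      where
      nb′ : ∀ y → adj G' (suc b) y ≡ true → y ≡ suc a
      nb′ y e′ with neighbours-of-old e′
      ... | inj₁ (refl , b-end) with partner b-end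
      ...   | w , bw , wb = ⊥-elim (¬ab (subst (λ t → SameEdge t b u v) (nb w bw) wb))
      nb′ y e′ | inj₂ (x , refl , bx , _) = cong suc (nb x bx)
    Pendant-lift {a} {b} (through {c = c} e c≢a nb p) ¬ab with SameEdge? b c u v
    ... | yes bc = through (trans (old-adj-kept s ¬ab) e) (λ ()) nb′ (Pendant-into-new p bc)
      where
      nb′ : ∀ y → adj G' (suc b) y ≡ true → y ≡ suc a ⊎ y ≡ zero
      nb′ y e′ with neighbours-of-old e′
      ... | inj₁ (refl , _) = inj₂ refl
      ... | inj₂ (x , refl , bx , ¬bx) with nb x bx
      ...   | inj₁ x≡a  = inj₁ (cong suc x≡a)
      ...   | inj₂ refl = ⊥-elim (¬bx bc)
    ... | no ¬bc =
      through (trans (old-adj-kept s ¬ab) e) (λ q → c≢a (suc-injective q)) nb′ (Pendant-lift p ¬bc)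
      where
      nb′ : ∀ y → adj G' (suc b) y ≡ true → y ≡ suc a ⊎ y ≡ suc c
      nb′ y e′ with neighbours-of-old e′
      ... | inj₁ (refl , b-end) with partner b-end
      ...   | w , bw , wb with nb w bw
      ...     | inj₁ refl = ⊥-elim (¬ab wb)
      ...     | inj₂ refl = ⊥-elim (¬bc (SameEdge-sym wb))
      nb′ y e′ | inj₂ (x , refl , bx , _) = Sum.map (cong suc) (cong suc) (nb x bx)

    Pendant-into-new : ∀ {a b} → Pendant G a b → SameEdge a b u v → Pendant G' (suc a) zero
    Pendant-into-new {a} {b} p ab =
      through (trans (adj-sym G' (suc a) zero) (new-adj-end s (SameEdge-endˡ ab)))
              (λ q → adj⇒≢ G (Pendant-edge p) (sym (suc-injective q))) nb′ (Pendant-from-new p ab)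
      where
      nb′ : ∀ y → adj G' zero y ≡ true → y ≡ suc a ⊎ y ≡ suc b
      nb′ zero    e = ⊥-elim (true≢false (trans (sym e) (irrefl G' zero)))
      nb′ (suc x) e = Sum.map (cong suc) (cong suc) (SameEdge-ends ab (new-adj⇒end s e))

    Pendant-from-new : ∀ {a b} → Pendant G a b → SameEdge a b u v → Pendant G' zero (suc b)
    Pendant-from-new {a} {b} (leaf e nb) ab = leaf (new-adj-end s (SameEdge-endˡ (SameEdge-sym ab))) nb′
      where
      nb′ : ∀ y → adj G' (suc b) y ≡ true → y ≡ zero
      nb′ y e′ with neighbours-of-old e′
      ... | inj₁ (refl , _) = refl
      ... | inj₂ (x , refl , bx , ¬bx) with nb x bx
      ...   | refl = ⊥-elim (¬bx (SameEdge-sym ab))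
    Pendant-from-new {a} {b} (through {c = c} e c≢a nb p) ab =
      through (new-adj-end s (SameEdge-endˡ (SameEdge-sym ab))) (λ ()) nb′
              (Pendant-lift p (SameEdge-next (adj⇒≢ G edge) c≢a ab))
      where
      nb′ : ∀ y → adj G' (suc b) y ≡ true → y ≡ zero ⊎ y ≡ suc c
      nb′ y e′ with neighbours-of-old e′
      ... | inj₁ (refl , _) = inj₁ refl
      ... | inj₂ (x , refl , bx , ¬bx) with nb x bx
      ...   | inj₁ refl = ⊥-elim (¬bx (SameEdge-sym ab))
      ...   | inj₂ x≡c  = inj₂ (cong suc x≡c)

  PendantEdges-SubdividedAt : PendantEdges G → PendantEdges G'
  PendantEdges-SubdividedAt pendant = pendant′
    where
    at-new-edge : ∀ {p q} → Pendant G p q → SameEdge p q u v →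
                  ∀ {x} → x ≡ u ⊎ x ≡ v → Pendant G' zero (suc x) ⊎ Pendant G' (suc x) zero
    at-new-edge pd pq x-end with SameEdge-ends pq x-end
    ... | inj₁ refl = inj₂ (Pendant-into-new pd pq)
    ... | inj₂ refl = inj₁ (Pendant-from-new pd pq)
    at-new : ∀ {x} → x ≡ u ⊎ x ≡ v → Pendant G' zero (suc x) ⊎ Pendant G' (suc x) zero
    at-new with pendant u v edge
    ... | inj₁ pd = at-new-edge pd (inj₁ (refl , refl))
    ... | inj₂ pd = at-new-edge pd (inj₂ (refl , refl))
    pendant′ : PendantEdges G'
    pendant′ zero    zero    e = ⊥-elim (true≢false (trans (sym e) (irrefl G' zero)))
    pendant′ zero    (suc x) e = at-new (new-adj⇒end s e)
    pendant′ (suc x) zero    e = Sum.swap (at-new (new-adj⇒end s (trans (adj-sym G' zero (suc x)) e)))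
    pendant′ (suc x) (suc y) e with pendant x y (old-adj⇒adj s e)
    ... | inj₁ p = inj₁ (Pendant-lift p λ same → true≢false (trans (sym e) (old-adj-cut s same)))
    ... | inj₂ p = inj₂ (Pendant-lift p λ same → true≢false (trans (sym e) (old-adj-cut s (SameEdge-sym same))))

PendantEdges-Subdivision : ∀ {h} {H : Graph h} → PendantEdges H →
                           ∀ {m} {S : Graph m} → Subdivision H S → PendantEdges S
PendantEdges-Subdivision pendant (base i) = PendantEdges-Iso i pendant
PendantEdges-Subdivision pendant (step d once) with SubdivideOnce⇒SubdividedAt once
... | _ , _ , s = PendantEdges-SubdividedAt s (PendantEdges-Subdivision pendant d)

PendantEdges-star : ∀ {r} {S : Graph (suc r)} → IsStarGraph S → PendantEdges S
PendantEdges-star {S = S} star = pendant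
  where
  spoke : ∀ j → Pendant S zero (suc j)
  spoke j = leaf (star zero (suc j)) λ
    { zero    _ → refl
    ; (suc y) e → ⊥-elim (true≢false (trans (sym e) (star (suc j) (suc y)))) }
  pendant : PendantEdges S
  pendant zero    zero    e = ⊥-elim (true≢false (trans (sym e) (irrefl S zero)))
  pendant zero    (suc j) _ = inj₁ (spoke j)
  pendant (suc i) zero    _ = inj₂ (spoke i)
  pendant (suc i) (suc j) e = ⊥-elim (true≢false (trans (sym e) (star (suc i) (suc j))))

module _ {p} {P : Graph p} (path : IsPathGraph P) where

  path-adj⇒ : ∀ {x y} → adj P x y ≡ true → toℕ y ≡ suc (toℕ x) ⊎ toℕ x ≡ suc (toℕ y)
  path-adj⇒ {x} {y} e with ∨≡true⇒ (trans (sym (path x y)) e)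
  ... | inj₁ r = inj₁ (sym (≡ᵇ⇒≡ _ _ (Equivalence.from T-≡ r)))
  ... | inj₂ r = inj₂ (sym (≡ᵇ⇒≡ _ _ (Equivalence.from T-≡ r)))

  path-adj : ∀ {x y} → toℕ y ≡ suc (toℕ x) → adj P x y ≡ true
  path-adj {x} {y} eq =
    trans (path x y) (cong (_∨ (suc (toℕ y) ≡ᵇ toℕ x)) (Equivalence.to T-≡ (≡⇒≡ᵇ _ _ (sym eq))))

  Pendant-forward : ∀ d {a b} → suc (toℕ b) + d ≡ p → toℕ b ≡ suc (toℕ a) → Pendant P a b
  Pendant-forward zero {a} {b} end eq = leaf (path-adj eq) nb
    where
    nb : ∀ y → adj P b y ≡ true → y ≡ a
    nb y e with path-adj⇒ e
    ... | inj₁ r = ⊥-elim (<⇒≢ (toℕ<n y) (trans r (trans (sym (+-identityʳ _)) end)))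
    ... | inj₂ r = toℕ-injective (ℕ.suc-injective (trans (sym r) eq))
  Pendant-forward (suc d) {a} {b} end eq = through (path-adj eq) c≢a nb (Pendant-forward d end′ tc)
    where
    end-suc : suc (suc (toℕ b) + d) ≡ p
    end-suc = trans (sym (+-suc (suc (toℕ b)) d)) end
    b+1<p : suc (toℕ b) < p
    b+1<p = ≤-trans (m≤m+n _ d) (≤-reflexive end-suc)
    c : Fin p
    c = fromℕ< b+1<p
    tc : toℕ c ≡ suc (toℕ b)
    tc = toℕ-fromℕ< b+1<p
    end′ : suc (toℕ c) + d ≡ p
    end′ = trans (cong (λ t → suc t + d) tc) end-suc
    c≢a : c ≢ a
    c≢a c≡a = m≢1+n+m (toℕ a) {1} (trans (sym (cong toℕ c≡a)) (trans tc (cong suc eq)))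
    nb : ∀ y → adj P b y ≡ true → y ≡ a ⊎ y ≡ c
    nb y e with path-adj⇒ e
    ... | inj₁ r = inj₂ (toℕ-injective (trans r (sym tc)))
    ... | inj₂ r = inj₁ (toℕ-injective (ℕ.suc-injective (trans (sym r) eq)))

  PendantEdges-path : PendantEdges P
  PendantEdges-path a b e with path-adj⇒ e
  ... | inj₁ r = inj₁ (Pendant-forward (p ∸ suc (toℕ b)) (m+[n∸m]≡n (toℕ<n b)) r)
  ... | inj₂ r = inj₂ (Pendant-forward (p ∸ suc (toℕ a)) (m+[n∸m]≡n (toℕ<n a)) r)

PendantEdges-pathOrSubdividedStar : ∀ {m} {C : Graph m} → IsPath C ⊎ IsSubdividedStar C → PendantEdges C
PendantEdges-pathOrSubdividedStar (inj₁ (_ , _ , path , iso)) = PendantEdges-Iso iso (PendantEdges-path path)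
PendantEdges-pathOrSubdividedStar (inj₂ (_ , _ , star , sub)) = PendantEdges-Subdivision (PendantEdges-star star) sub

-- A component is the image of a neighbour-closed embedding, so pendant paths in it are pendant in H.
PendantEdges-components : ∀ {h} (H : Graph h) → ComponentsPathsOrSubdividedStars H → PendantEdges H
PendantEdges-components H components a b e with components a
... | _ , φ , φ-inj , component , shape
  with proj₁ (component a) here | proj₁ (component b) (there here e)
...   | i , refl | j , refl =
  PendantEdges-↪ (Induce-↪ H φ-inj) closed (PendantEdges-pathOrSubdividedStar shape) e
  where
  closed : NeighbourClosed (Induce-↪ H φ-inj)
  closed k y e′ = proj₁ (component y) (there (proj₂ (component (φ k)) k refl) e′)

-- Greedy packing of induced copies

-- The predicate must respect pointwise equality because functions are compared without extensionality.
anyFunction? : ∀ h {n} (P : (Fin h → Fin n) → Set) → (∀ {f g} → (∀ x → f x ≡ g x) → P f → P g) →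
               (∀ f → Dec (P f)) → Dec (∃ P)
anyFunction? zero P resp P? with P? (λ ())
... | yes p = yes (_ , p)
... | no ¬p = no λ { (f , pf) → ¬p (resp (λ ()) pf) }
anyFunction? (suc h) P resp P?
  with any? (λ a → anyFunction? h (λ g → P (a ∷ g)) (λ e → resp λ { zero → refl ; (suc x) → e x })
                                 (λ g → P? (a ∷ g)))
... | yes (a , g , pg) = yes (a ∷ g , pg)
... | no ¬q =
  no λ { (f , pf) → ¬q (f zero , (λ x → f (suc x)) , resp (λ { zero → refl ; (suc x) → refl }) pf) }

module Greedy {h n} (H : Graph h) (G : Graph n) where
  open _↪_
  open DecMembership (_≟_ {n = n}) using (_∈?_)

  HitsAllCopies : List (Fin n) → Set
  HitsAllCopies X = ∀ (f : H ↪ G) → ∃ λ x → embed f x ∈ X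

  copyAvoiding? : ∀ X → (∃ λ (f : H ↪ G) → ∀ x → embed f x ∉ X) ⊎ HitsAllCopies X
  copyAvoiding? X with anyFunction? h Good Good-resp (λ ψ → injective? ψ ×-dec (adj? ψ ×-dec avoids? ψ))
    where
    Good : (Fin h → Fin n) → Set
    Good ψ = Injective _≡_ _≡_ ψ × (∀ x y → adj G (ψ x) (ψ y) ≡ adj H x y) × (∀ x → ψ x ∉ X)
    Good-resp : ∀ {f g} → (∀ x → f x ≡ g x) → Good f → Good g
    Good-resp {f} {g} f≗g (f-inj , f-adj , f∉) =
      (λ {x} {y} e → f-inj (trans (f≗g x) (trans e (sym (f≗g y))))) ,
      (λ x y → trans (cong₂ (adj G) (sym (f≗g x)) (sym (f≗g y))) (f-adj x y)) ,
      (λ x → subst (_∉ X) (f≗g x) (f∉ x))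
    injective? : ∀ ψ → Dec (Injective _≡_ _≡_ ψ)
    injective? ψ = map′ (λ inj {x} {y} → inj x y) (λ inj x y → inj {x} {y})
                        (all? λ x → all? λ y → (ψ x ≟ ψ y) →-dec (x ≟ y))
    adj? : ∀ ψ → Dec (∀ x y → adj G (ψ x) (ψ y) ≡ adj H x y)
    adj? ψ = all? λ x → all? λ y → adj G (ψ x) (ψ y) Bool.≟ adj H x y
    avoids? : ∀ ψ → Dec (∀ x → ψ x ∉ X)
    avoids? ψ = all? λ x → ¬? (ψ x ∈? X)
  ... | yes (ψ , ψ-inj , ψ-adj , ψ∉) = inj₁ (embedding ψ ψ-inj ψ-adj , ψ∉)
  ... | no ∄ψ = inj₂ λ f → Dec.decidable-stable (any? λ x → embed f x ∈? X)
                              λ ∄x → ∄ψ (embed f , embed-injective f , embed-adj f , λ x e → ∄x (x , e))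

  record Packing (k : ℕ) : Set where
    field
      copies      : Fin k → H ↪ G
      used        : List (Fin n)
      used-length : length used ≡ h * k
      ∈-used      : ∀ i x → embed (copies i) x ∈ used
      disjoint    : ∀ i j → i ≢ j → ∀ a b → embed (copies i) a ≢ embed (copies j) b

  emptyPacking : Packing 0
  emptyPacking = record
    { copies = λ () ; used = [] ; used-length = sym (*-zeroʳ h) ; ∈-used = λ () ; disjoint = λ () }

  extend : ∀ {k} (P : Packing k) (f : H ↪ G) → (∀ x → embed f x ∉ Packing.used P) → Packing (suc k)
  extend {k} P f f∉ = record
    { copies = f ∷ copies ; used = tabulate (embed f) ++ used ; used-length = used-length′
    ; ∈-used = ∈-used′ ; disjoint = disjoint′ }
    where
    open Packing P
    used-length′ : length (tabulate (embed f) ++ used) ≡ h * suc k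
    used-length′ = begin
      length (tabulate (embed f) ++ used)        ≡⟨ length-++ (tabulate (embed f)) ⟩
      length (tabulate (embed f)) + length used  ≡⟨ cong₂ _+_ (length-tabulate (embed f)) used-length ⟩
      h + h * k                                  ≡⟨ sym (*-suc h k) ⟩
      h * suc k                                  ∎
      where open ≡-Reasoning
    ∈-used′ : ∀ i x → embed ((f ∷ copies) i) x ∈ tabulate (embed f) ++ used
    ∈-used′ zero    x = ∈-++⁺ˡ (∈-tabulate⁺ x)
    ∈-used′ (suc i) x = ∈-++⁺ʳ (tabulate (embed f)) (∈-used i x)
    disjoint′ : ∀ i j → i ≢ j → ∀ a b → embed ((f ∷ copies) i) a ≢ embed ((f ∷ copies) j) b
    disjoint′ zero    zero    i≢j = ⊥-elim (i≢j refl)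
    disjoint′ zero    (suc j) _ a b e = f∉ a (subst (_∈ used) (sym e) (∈-used j b))
    disjoint′ (suc i) zero    _ a b e = f∉ b (subst (_∈ used) e (∈-used i a))
    disjoint′ (suc i) (suc j) i≢j = disjoint i j (λ e → i≢j (cong suc e))

  greedy : ∀ k → Packing k ⊎ ∃ λ X → length X ≤ h * k × HitsAllCopies X
  greedy zero = inj₁ emptyPacking
  greedy (suc k) with greedy k
  ... | inj₂ (X , |X|≤ , hits) = inj₂ (X , ≤-trans |X|≤ (*-monoʳ-≤ h (n≤1+n k)) , hits)
  ... | inj₁ P with copyAvoiding? (Packing.used P)
  ...   | inj₁ (f , f∉) = inj₁ (extend P f f∉)
  ...   | inj₂ hits     =
    inj₂ (Packing.used P , ≤-trans (≤-reflexive (Packing.used-length P)) (*-monoʳ-≤ h (n≤1+n k)) , hits)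

↪⇒SubdivCopy : ∀ {h n} {H : Graph h} {G : Graph n} → H ↪ G → SubdivCopy H G
↪⇒SubdivCopy (embedding ψ ψ-inj ψ-adj) = record
  { size = _ ; emb = ψ ; inj = ψ-inj
  ; isSub = base (record { to = λ x → x ; from = λ x → x ; from-to = λ _ → refl ; to-from = λ _ → refl
                         ; adj-pres = λ x y → sym (ψ-adj x y) }) }

hits-subdivisions : ∀ {h n} {H : Graph h} {G : Graph n} {X : List (Fin n)} → PendantEdges H →
  Greedy.HitsAllCopies H G X → ∀ (C : SubdivCopy H G) → ∃ λ a → emb C a ∈ X
hits-subdivisions {G = G} pendant hits C =
  let x , x∈X = hits (↪-trans (PendantEdges⇒↪-Subdivision pendant (isSub C)) (Induce-↪ G (inj C)))
  in _ , x∈X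

lemma3p3 : ∀ {h} (H : Graph h) → ComponentsPathsOrSubdividedStars H →
    Σ ℕ λ c → ∀ {n} (G : Graph n) (k : ℕ) → 1 ≤ k →
      DisjointCopies H G k ⊎ HittingSet H G (c * k)
lemma3p3 {h} H components = h , λ G k _ → Sum.map packed hit (Greedy.greedy H G k)
  where
  packed : ∀ {n k} {G : Graph n} → Greedy.Packing H G k → DisjointCopies H G k
  packed P = (λ i → ↪⇒SubdivCopy (copies i)) , disjoint
    where open Greedy.Packing P
  hit : ∀ {n k} {G : Graph n} → (∃ λ X → length X ≤ h * k × Greedy.HitsAllCopies H G X) →
        HittingSet H G (h * k)
  hit (X , |X|≤ , hits) = X , |X|≤ , hits-subdivisions (PendantEdges-components H components) hits
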